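{- For all integers $\ell\ge 0$ and $k\ge 3$, every graph $G$ that is both $(P_4+\ell P_1)$-free and $K_k$-free satisfies $$\chi(G)\le \ell^{k-2}+2\ell^{k-3}+3\ell^{k-4}+\cdots+(k-2)\ell+(k-1)=\sum_{i=1}^{k-1} i\,\ell^{k-1-i}.$$
   Context: All graphs are finite and simple. A graph is $F$-free if it has no induced subgraph isomorphic to $F$. $P_4$ is the path on four vertices, $P_4+\ell P_1$ is the disjoint union of $P_4$ with $\ell$ isolated vertices, and $K_k$ is the complete graph on $k$ vertices. $\chi(G)$ is the chromatic number (with the convention $\ell^0=1$). -}

module Defs where

open import Data.Nat using (ℕ; zero; suc; _+_; _*_; _∸_; _^_; _<ᵇ_; _≡ᵇ_)
open import Data.Bool using (Bool; true; false; _∧_; _∨_; not; T)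
open import Data.Fin using (Fin; toℕ)
open import Data.List using (map; upTo)
open import Data.Nat.ListAction using (sum)
open import Data.Product using (Σ; ∃; _×_)
open import Relation.Binary.PropositionalEquality using (_≡_; _≢_)
open import Relation.Nullary using (¬_)
open import Function.Definitions using (Injective)

record Graph : Set where
  field
    n    : ℕ
    adj  : Fin n → Fin n → Bool
    sym  : ∀ i j → adj i j ≡ adj j i
    irr  : ∀ i → adj i i ≡ false

open Graph public

InducedCopy : (m : ℕ) → (Fin m → Fin m → Bool) → Graph → Set
InducedCopy m fadj G =
  Σ (Fin m → Fin (n G)) λ f →
    Injective _≡_ _≡_ f × (∀ i j → fadj i j ≡ adj G (f i) (f j))

Free : (m : ℕ) → (Fin m → Fin m → Bool) → Graph → Set
Free m fadj G = ¬ InducedCopy m fadj G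

-- P₄ + ℓP₁ on vertices 0..3+ℓ: path 0-1-2-3, vertices ≥ 4 isolated.
P4+P1s-adj : (ℓ : ℕ) → Fin (4 + ℓ) → Fin (4 + ℓ) → Bool
P4+P1s-adj ℓ i j =
  (toℕ i <ᵇ 4) ∧ (toℕ j <ᵇ 4) ∧ ((suc (toℕ i) ≡ᵇ toℕ j) ∨ (suc (toℕ j) ≡ᵇ toℕ i))

K-adj : (k : ℕ) → Fin k → Fin k → Bool
K-adj k i j = not (toℕ i ≡ᵇ toℕ j)

ProperColouring : Graph → ℕ → Set
ProperColouring G c =
  Σ (Fin (n G) → Fin c) λ col → ∀ u v → T (adj G u v) → col u ≢ col v

χ≤ : Graph → ℕ → Set
χ≤ G c = ProperColouring G c

-- ∑_{i=1}^{k-1} i ℓ^{k-1-i}  (with ℓ^0 = 1; written with j = i-1)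
bound : ℕ → ℕ → ℕ
bound ℓ k = sum (map (λ j → suc j * ℓ ^ (k ∸ 2 ∸ j)) (upTo (k ∸ 1)))

-- For a vertex v, its neighbourhood is K_{k-1}-free, and its
-- non-neighbours other than v are (P₄ + (ℓ-1)P₁)-free, since v would extend an induced
-- P₄ + (ℓ-1)P₁ among them to an induced P₄ + ℓP₁. Splitting off neighbourhoods ℓ times thus
-- costs ℓ·f(k-1) colours, f(k-1) bounding the chromatic number of K_{k-1}-free sets, and leaves
-- a P₄-free K_k-free set. That set is (k-1)-colourable: in a P₄-free graph every maximal clique
-- meets every maximal independent set (Seinsche), so deleting a maximal independent set lowers
-- the clique number. Hence f(k) = ℓ·f(k-1) + (k-1) with f(2) = 1, which unfolds to the sum.
module Submission where

open import Defs hiding (sym)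
open import Data.Bool using (Bool; true; false; not; T)
import Data.Bool.Properties as Bool
open import Data.Empty using (⊥-elim)
open import Data.Fin using (Fin; zero; suc; toℕ; fromℕ; inject₁; inject≤; punchIn; punchOut; _↑ˡ_; _↑ʳ_; splitAt; _≟_)
open import Data.Fin.Patterns using (0F; 1F; 2F; 3F)
open import Data.Fin.Properties
  using (any?; all?; punchIn-punchOut; toℕ-inject₁; toℕ-injective; inject≤-injective; ↑ˡ-injective; ↑ʳ-injective; splitAt-↑ˡ; splitAt-↑ʳ)
open import Data.Fin.Subset using (Subset; _∈_; _∉_; _⊆_; _⊃_; _∩_; _∪_; ∁; ⁅_⁆; ⊤) renaming (⊥ to ∅)
open import Data.Fin.Subset.Properties
  using (_∈?_; nonempty?; ∈⊤; ∉⊥; ⊥⊆; ⊆-trans; x∈⁅x⁆; x∈⁅y⁆⇒x≡y; p⊆p∪q; x∈p∪q⁺; x∈p∪q⁻; x∈p∩q⁺; x∈p∩q⁻; p∩q⊆p; x∈∁p⇒x∉p; x∉p⇒x∈∁p)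
open import Data.Fin.Subset.Induction using (Acc; acc; ⊃-wellFounded)
open import Data.List using ([]; _∷_; [_]; _++_; map; upTo; _∷ʳ_)
open import Data.List.Properties using (map-++; map-cong-local; upTo-∷ʳ)
open import Data.List.Membership.Propositional.Properties using (∈-upTo⁻)
import Data.List.Relation.Unary.All as All
open import Data.Nat using (ℕ; zero; suc; _+_; _*_; _∸_; _^_; _≤_; _<ᵇ_; s≤s)
open import Data.Nat.ListAction using (sum)
open import Data.Nat.ListAction.Properties using (sum-++)
open import Data.Nat.Properties
  using (+-assoc; +-identityʳ; *-identityʳ; *-zeroʳ; *-assoc; *-comm; *-distribˡ-+; +-∸-assoc; n∸n≡0; m≤n+m; ≤-pred; ≡ᵇ⇒≡; ≡⇒≡ᵇ)
open import Data.Product using (Σ; ∃; ∃-syntax; _×_; _,_; proj₁; proj₂)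
open import Data.Sum using (_⊎_; inj₁; inj₂; [_,_]′)
open import Data.Vec using (tabulate)
open import Data.Vec.Properties using (lookup∘tabulate; lookup⇒[]=; []=⇒lookup)
open import Data.Vec.Functional using (insertAt) renaming (_∷_ to _◂_; [] to ◂[])
open import Data.Vec.Functional.Properties using (insertAt-lookup; insertAt-punchIn)
open import Function using (_∘_; _on_)
open import Function.Bundles using (Equivalence)
open import Function.Definitions using (Injective)
open import Relation.Binary.Construct.On using (wellFounded)
open import Relation.Binary.PropositionalEquality using (_≡_; _≢_; refl; sym; trans; cong; cong₂; subst; module ≡-Reasoning)
open import Relation.Nullary using (¬_; yes; no; contradiction)
open import Relation.Nullary.Decidable using (decidable-stable; dec-false; from-yes; _×-dec_; _⊎-dec_; _→-dec_; ¬?)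

∈-tabulate⁺ : ∀ {m} (f : Fin m → Bool) {i} → T (f i) → i ∈ tabulate f
∈-tabulate⁺ f {i} fi = lookup⇒[]= i (tabulate f) (trans (lookup∘tabulate f i) (Equivalence.to Bool.T-≡ fi))

∈-tabulate⁻ : ∀ {m} (f : Fin m → Bool) {i} → i ∈ tabulate f → T (f i)
∈-tabulate⁻ f {i} i∈f = Equivalence.from Bool.T-≡ (trans (sym (lookup∘tabulate f i)) ([]=⇒lookup i∈f))

∈-∪⁅⁆⁻ : ∀ {m} {p : Subset m} {x y} → x ∈ p ∪ ⁅ y ⁆ → x ∈ p ⊎ x ≡ y
∈-∪⁅⁆⁻ {p = p} {y = y} x∈ with x∈p∪q⁻ p ⁅ y ⁆ x∈
... | inj₁ x∈p = inj₁ x∈p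
... | inj₂ x∈y = inj₂ (x∈⁅y⁆⇒x≡y y x∈y)

↑ˡ≢↑ʳ : ∀ {a b} (i : Fin a) (j : Fin b) → i ↑ˡ b ≢ a ↑ʳ j
↑ˡ≢↑ʳ {a} {b} i j eq with trans (sym (splitAt-↑ˡ a i b)) (trans (cong (splitAt a) eq) (splitAt-↑ʳ a b j))
... | ()

TwinFree : ∀ {m} → (Fin m → Fin m → Bool) → Set
TwinFree {m} F = ∀ (i j : Fin m) → i ≡ j ⊎ ∃[ k ] F i k ≢ F j k

P₄ : Fin 4 → Fin 4 → Bool
P₄ = P4+P1s-adj 0

P₄-twinFree : TwinFree P₄
P₄-twinFree = from-yes (all? λ i → all? λ j → i ≟ j ⊎-dec any? λ k → ¬? (P₄ i k Bool.≟ P₄ j k))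

P4+P1s-adj-last : ∀ ℓ (i : Fin (4 + suc ℓ)) →
  P4+P1s-adj (suc ℓ) (fromℕ (4 + ℓ)) i ≡ false × P4+P1s-adj (suc ℓ) i (fromℕ (4 + ℓ)) ≡ false
P4+P1s-adj-last ℓ i = refl , Bool.∧-zeroʳ (toℕ i <ᵇ 4)

punchIn-fromℕ : ∀ {m} (i : Fin m) → punchIn (fromℕ m) i ≡ inject₁ i
punchIn-fromℕ zero = refl
punchIn-fromℕ (suc i) = cong suc (punchIn-fromℕ i)

P4+P1s-adj-punchIn : ∀ ℓ (i j : Fin (4 + ℓ)) →
  P4+P1s-adj (suc ℓ) (punchIn (fromℕ (4 + ℓ)) i) (punchIn (fromℕ (4 + ℓ)) j) ≡ P4+P1s-adj ℓ i j
P4+P1s-adj-punchIn ℓ i j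
  rewrite punchIn-fromℕ i | punchIn-fromℕ j | toℕ-inject₁ i | toℕ-inject₁ j = refl

data PunchView {m} (p : Fin (suc m)) : Fin (suc m) → Set where
  hole    : PunchView p p
  punched : ∀ i → PunchView p (punchIn p i)

punchView : ∀ {m} (p x : Fin (suc m)) → PunchView p x
punchView p x with p ≟ x
... | yes refl = hole
... | no p≢x   = subst (PunchView p) (punchIn-punchOut p≢x) (punched (punchOut p≢x))

*-distribˡ-sum : ∀ a (f : ℕ → ℕ) xs → a * sum (map f xs) ≡ sum (map (λ x → a * f x) xs)
*-distribˡ-sum a f [] = *-zeroʳ a
*-distribˡ-sum a f (x ∷ xs) = trans (*-distribˡ-+ a (f x) _) (cong (a * f x +_) (*-distribˡ-sum a f xs))

bound-suc : ∀ ℓ m → bound ℓ (3 + m) ≡ ℓ * bound ℓ (2 + m) + (2 + m)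
bound-suc ℓ m = begin
  sum (map term (upTo (2 + m)))                       ≡⟨ cong (sum ∘ map term) (upTo-∷ʳ (suc m)) ⟨
  sum (map term (upTo (suc m) ∷ʳ suc m))              ≡⟨ cong sum (map-++ term (upTo (suc m)) [ suc m ]) ⟩
  sum (map term (upTo (suc m)) ++ [ term (suc m) ])   ≡⟨ sum-++ (map term (upTo (suc m))) [ term (suc m) ] ⟩
  sum (map term (upTo (suc m))) + (term (suc m) + 0)  ≡⟨ cong₂ _+_ lower-terms top-term ⟩
  ℓ * sum (map term′ (upTo (suc m))) + (2 + m)        ∎
  where
  open ≡-Reasoning
  term term′ : ℕ → ℕ
  term j = suc j * ℓ ^ (suc m ∸ j)
  term′ j = suc j * ℓ ^ (m ∸ j)

  term≡ℓ*term′ : ∀ {j} → j ≤ m → term j ≡ ℓ * term′ j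
  term≡ℓ*term′ {j} j≤m = begin
    suc j * ℓ ^ (suc m ∸ j)    ≡⟨ cong (λ e → suc j * ℓ ^ e) (+-∸-assoc 1 j≤m) ⟩
    suc j * (ℓ * ℓ ^ (m ∸ j))  ≡⟨ *-assoc (suc j) ℓ _ ⟨
    suc j * ℓ * ℓ ^ (m ∸ j)    ≡⟨ cong (_* ℓ ^ (m ∸ j)) (*-comm (suc j) ℓ) ⟩
    ℓ * suc j * ℓ ^ (m ∸ j)    ≡⟨ *-assoc ℓ (suc j) _ ⟩
    ℓ * term′ j                ∎

  lower-terms : sum (map term (upTo (suc m))) ≡ ℓ * sum (map term′ (upTo (suc m)))
  lower-terms = trans (cong sum (map-cong-local (All.tabulate (term≡ℓ*term′ ∘ ≤-pred ∘ ∈-upTo⁻))))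
                      (sym (*-distribˡ-sum ℓ term′ (upTo (suc m))))

  top-term : term (suc m) + 0 ≡ 2 + m
  top-term rewrite n∸n≡0 m = trans (+-identityʳ _) (*-identityʳ _)

module _ (G : Graph) where

  Vertex : Set
  Vertex = Fin (n G)

  VertexSet : Set
  VertexSet = Subset (n G)

  infix 4 _~_
  _~_ : Vertex → Vertex → Set
  u ~ w = T (adj G u w)

  ~-sym : ∀ {u w} → u ~ w → w ~ u
  ~-sym {u} {w} = subst T (Graph.sym G u w)

  ~-irrefl : ∀ {u} → ¬ u ~ u
  ~-irrefl {u} = subst T (irr G u)

  ~⇒≢ : ∀ {u w} → u ~ w → u ≢ w
  ~⇒≢ u~w refl = ~-irrefl u~w

  edge : ∀ {u w} → u ~ w → adj G u w ≡ true
  edge = Equivalence.to Bool.T-≡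

  non-edge : ∀ {u w} → ¬ u ~ w → adj G u w ≡ false
  non-edge {u} {w} = dec-false (Bool.T? (adj G u w))

  nbhd : Vertex → VertexSet
  nbhd v = tabulate (adj G v)

  ∈-nbhd⁺ : ∀ {v u} → v ~ u → u ∈ nbhd v
  ∈-nbhd⁺ {v} = ∈-tabulate⁺ (adj G v)

  ∈-nbhd⁻ : ∀ {v u} → u ∈ nbhd v → v ~ u
  ∈-nbhd⁻ {v} = ∈-tabulate⁻ (adj G v)

  nonNbhd : Vertex → VertexSet
  nonNbhd v = ∁ (nbhd v ∪ ⁅ v ⁆)

  ∈-nonNbhd⁺ : ∀ {v u} → ¬ v ~ u → u ≢ v → u ∈ nonNbhd v
  ∈-nonNbhd⁺ v≁u u≢v = x∉p⇒x∈∁p ([ v≁u ∘ ∈-nbhd⁻ , u≢v ]′ ∘ ∈-∪⁅⁆⁻)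

  ∈-nonNbhd⁻ : ∀ {v u} → u ∈ nonNbhd v → ¬ v ~ u × u ≢ v
  ∈-nonNbhd⁻ {v} {u} u∈ = (λ v~u → u∉ (x∈p∪q⁺ (inj₁ (∈-nbhd⁺ v~u))))
                    , (λ { refl → u∉ (x∈p∪q⁺ (inj₂ (x∈⁅x⁆ v))) })
    where
    u∉ : u ∉ nbhd v ∪ ⁅ v ⁆
    u∉ = x∈∁p⇒x∉p u∈

  record CopyIn (m : ℕ) (F : Fin m → Fin m → Bool) (X : VertexSet) : Set where
    field
      vertex    : Fin m → Vertex
      injective : Injective _≡_ _≡_ vertex
      vertex∈X  : ∀ i → vertex i ∈ X
      induced   : ∀ i j → F i j ≡ adj G (vertex i) (vertex j)

  FreeIn : (m : ℕ) → (Fin m → Fin m → Bool) → VertexSet → Set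
  FreeIn m F X = ¬ CopyIn m F X

  CopyIn-⊆ : ∀ {m F X Y} → X ⊆ Y → CopyIn m F X → CopyIn m F Y
  CopyIn-⊆ X⊆Y c = record { CopyIn c ; vertex∈X = X⊆Y ∘ CopyIn.vertex∈X c }

  FreeIn-antitone : ∀ {m F X Y} → Y ⊆ X → FreeIn m F X → FreeIn m F Y
  FreeIn-antitone Y⊆X free = free ∘ CopyIn-⊆ Y⊆X

  record IsCliqueIn {k : ℕ} (q : Fin k → Vertex) (X : VertexSet) : Set where
    field
      ∈X       : ∀ i → q i ∈ X
      adjacent : ∀ {i j} → i ≢ j → q i ~ q j

  CliqueFree : ℕ → VertexSet → Set
  CliqueFree k X = ∀ (q : Fin k → Vertex) → ¬ IsCliqueIn q X

  IsCliqueIn-⊆ : ∀ {k X Y} {q : Fin k → Vertex} → X ⊆ Y → IsCliqueIn q X → IsCliqueIn q Y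
  IsCliqueIn-⊆ X⊆Y clique = record { IsCliqueIn clique ; ∈X = X⊆Y ∘ IsCliqueIn.∈X clique }

  CliqueFree-antitone : ∀ {k X Y} → Y ⊆ X → CliqueFree k X → CliqueFree k Y
  CliqueFree-antitone Y⊆X free q = free q ∘ IsCliqueIn-⊆ Y⊆X

  cliqueFree₂⇒independent : ∀ {X} → CliqueFree 2 X → ∀ {u w} → u ∈ X → w ∈ X → ¬ u ~ w
  cliqueFree₂⇒independent free {u} {w} u∈X w∈X u~w = free (u ◂ w ◂ ◂[]) record
    { ∈X       = λ { 0F → u∈X ; 1F → w∈X }
    ; adjacent = λ { {0F} {0F} 0≢0 → ⊥-elim (0≢0 refl)
                   ; {0F} {1F} _ → u~w
                   ; {1F} {0F} _ → ~-sym u~w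
                   ; {1F} {1F} 1≢1 → ⊥-elim (1≢1 refl) } }

  clique-cons : ∀ {k X w} {q : Fin k → Vertex} → IsCliqueIn q X → w ∈ X → (∀ i → w ~ q i) →
    IsCliqueIn (w ◂ q) X
  clique-cons {w = w} {q} clique w∈X w~q = record { ∈X = ∈X′ ; adjacent = adjacent′ }
    where
    open IsCliqueIn clique
    ∈X′ : ∀ i → (w ◂ q) i ∈ _
    ∈X′ zero    = w∈X
    ∈X′ (suc i) = ∈X i
    adjacent′ : ∀ {i j} → i ≢ j → (w ◂ q) i ~ (w ◂ q) j
    adjacent′ {zero}  {zero}  0≢0 = ⊥-elim (0≢0 refl)
    adjacent′ {zero}  {suc j} _   = w~q j
    adjacent′ {suc i} {zero}  _   = ~-sym (w~q i)
    adjacent′ {suc i} {suc j} i≢j = adjacent (i≢j ∘ cong suc)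

  CliqueFree-nbhd : ∀ {k X v} → CliqueFree (suc k) X → v ∈ X → CliqueFree k (X ∩ nbhd v)
  CliqueFree-nbhd {X = X} {v} free v∈X q clique =
    free (v ◂ q) (clique-cons (IsCliqueIn-⊆ (p∩q⊆p X _) clique) v∈X (∈-nbhd⁻ ∘ proj₂ ∘ x∈p∩q⁻ X _ ∘ ∈X))
    where open IsCliqueIn clique

  clique-injective : ∀ {k X} {q : Fin k → Vertex} → IsCliqueIn q X → Injective _≡_ _≡_ q
  clique-injective clique {i} {j} qi≡qj =
    decidable-stable (i ≟ j) λ i≢j → ~⇒≢ (IsCliqueIn.adjacent clique i≢j) qi≡qj

  injective-if-twinFree : ∀ {m} {F : Fin m → Fin m → Bool} {f : Fin m → Vertex} → TwinFree F →
    (∀ i j → F i j ≡ adj G (f i) (f j)) → Injective _≡_ _≡_ f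
  injective-if-twinFree {F = F} {f} twinFree induced {i} {j} fi≡fj with twinFree i j
  ... | inj₁ i≡j = i≡j
  ... | inj₂ (k , Fik≢Fjk) = contradiction F-agrees Fik≢Fjk
    where
    open ≡-Reasoning
    F-agrees : F i k ≡ F j k
    F-agrees = begin
      F i k              ≡⟨ induced i k ⟩
      adj G (f i) (f k)  ≡⟨ cong (λ x → adj G x (f k)) fi≡fj ⟩
      adj G (f j) (f k)  ≡⟨ induced j k ⟨
      F j k              ∎

  path-copy : ∀ {X a b c d} → a ∈ X → b ∈ X → c ∈ X → d ∈ X →
    a ~ b → b ~ c → c ~ d → ¬ a ~ c → ¬ a ~ d → ¬ b ~ d → CopyIn 4 P₄ X
  path-copy {a = a} {b} {c} {d} a∈X b∈X c∈X d∈X ab bc cd ¬ac ¬ad ¬bd = record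
    { vertex    = path
    ; injective = injective-if-twinFree P₄-twinFree induced
    ; vertex∈X  = λ { 0F → a∈X ; 1F → b∈X ; 2F → c∈X ; 3F → d∈X }
    ; induced   = induced
    }
    where
    path : Fin 4 → Vertex
    path = a ◂ b ◂ c ◂ d ◂ ◂[]
    induced : ∀ i j → P₄ i j ≡ adj G (path i) (path j)
    induced 0F 0F = sym (irr G a)
    induced 0F 1F = sym (edge ab)
    induced 0F 2F = sym (non-edge ¬ac)
    induced 0F 3F = sym (non-edge ¬ad)
    induced 1F 0F = sym (edge (~-sym ab))
    induced 1F 1F = sym (irr G b)
    induced 1F 2F = sym (edge bc)
    induced 1F 3F = sym (non-edge ¬bd)
    induced 2F 0F = sym (non-edge (¬ac ∘ ~-sym))
    induced 2F 1F = sym (edge (~-sym bc))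
    induced 2F 2F = sym (irr G c)
    induced 2F 3F = sym (edge cd)
    induced 3F 0F = sym (non-edge (¬ad ∘ ~-sym))
    induced 3F 1F = sym (non-edge (¬bd ∘ ~-sym))
    induced 3F 2F = sym (edge (~-sym cd))
    induced 3F 3F = sym (irr G d)

  copyIn-insert : ∀ {m} {F : Fin (suc m) → Fin (suc m) → Bool} (p : Fin (suc m)) →
    (∀ i → F p i ≡ false × F i p ≡ false) →
    ∀ {X Z v} → CopyIn m (λ i j → F (punchIn p i) (punchIn p j)) Z → Z ⊆ X → v ∈ X →
    (∀ {u} → u ∈ Z → ¬ v ~ u × u ≢ v) → CopyIn (suc m) F X
  copyIn-insert {m} {F} p p-isolated {X} {Z} {v} c Z⊆X v∈X Z-apart = record
    { vertex = e ; injective = e-injective ; vertex∈X = e∈X ; induced = e-induced }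
    where
    open CopyIn c
    e : Fin (suc m) → Vertex
    e = insertAt vertex p v

    e-hole : e p ≡ v
    e-hole = insertAt-lookup vertex p v

    e-punched : ∀ i → e (punchIn p i) ≡ vertex i
    e-punched = insertAt-punchIn vertex p v

    v≢vertex : ∀ i → v ≢ vertex i
    v≢vertex i = proj₂ (Z-apart (vertex∈X i)) ∘ sym

    e-injective : Injective _≡_ _≡_ e
    e-injective {x} {y} ex≡ey with punchView p x | punchView p y
    ... | hole      | hole      = refl
    ... | hole      | punched j = contradiction (trans (sym e-hole) (trans ex≡ey (e-punched j))) (v≢vertex j)
    ... | punched i | hole      = contradiction (trans (sym e-hole) (trans (sym ex≡ey) (e-punched i))) (v≢vertex i)
    ... | punched i | punched j =
      cong (punchIn p) (injective (trans (sym (e-punched i)) (trans ex≡ey (e-punched j))))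

    e∈X : ∀ x → e x ∈ X
    e∈X x with punchView p x
    ... | hole      = subst (_∈ X) (sym e-hole) v∈X
    ... | punched i = subst (_∈ X) (sym (e-punched i)) (Z⊆X (vertex∈X i))

    v≁ : ∀ i → adj G v (vertex i) ≡ false
    v≁ i = non-edge (proj₁ (Z-apart (vertex∈X i)))

    e-induced : ∀ x y → F x y ≡ adj G (e x) (e y)
    e-induced x y with punchView p x | punchView p y
    ... | hole | hole rewrite e-hole = trans (proj₁ (p-isolated p)) (sym (irr G v))
    ... | hole | punched j rewrite e-hole | e-punched j = trans (proj₁ (p-isolated _)) (sym (v≁ j))
    ... | punched i | hole rewrite e-hole | e-punched i =
      trans (proj₂ (p-isolated _)) (sym (trans (Graph.sym G (vertex i) v) (v≁ i)))
    ... | punched i | punched j rewrite e-punched i | e-punched j = induced i j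

  FreeIn-nonNbhd : ∀ {ℓ X v} → FreeIn (4 + suc ℓ) (P4+P1s-adj (suc ℓ)) X → v ∈ X →
    FreeIn (4 + ℓ) (P4+P1s-adj ℓ) (X ∩ nonNbhd v)
  FreeIn-nonNbhd {ℓ} {X} free v∈X c = free (copyIn-insert (fromℕ (4 + ℓ)) (P4+P1s-adj-last ℓ)
    record { CopyIn c ; induced = λ i j → trans (P4+P1s-adj-punchIn ℓ i j) (CopyIn.induced c i j) }
    (p∩q⊆p X _) v∈X (∈-nonNbhd⁻ ∘ proj₂ ∘ x∈p∩q⁻ X _))

  ColouringOf : VertexSet → ℕ → Set
  ColouringOf X c = Σ (Vertex → Fin c) λ col → ∀ {u w} → u ∈ X → w ∈ X → u ~ w → col u ≢ col w

  ColouringOf-weaken : ∀ {X c d} → c ≤ d → ColouringOf X c → ColouringOf X d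
  ColouringOf-weaken c≤d (col , proper) =
    (λ u → inject≤ (col u) c≤d) , λ u∈X w∈X u~w → proper u∈X w∈X u~w ∘ inject≤-injective c≤d c≤d _ _

  independent-colouring : ∀ {X} → (∀ {u w} → u ∈ X → w ∈ X → ¬ u ~ w) → ColouringOf X 1
  independent-colouring independent = (λ _ → zero) , λ u∈X w∈X u~w _ → independent u∈X w∈X u~w

  colouring-join : ∀ {X A B a b} → ColouringOf (X ∩ A) a → ColouringOf B b →
    (∀ {u w} → u ∈ X → w ∈ X → u ∉ A → w ∉ A → u ~ w → u ∈ B × w ∈ B) → ColouringOf X (a + b)
  colouring-join {X} {A} {B} {a} {b} (colA , properA) (colB , properB) outside-A-in-B = col , proper
    where
    col : Vertex → Fin (a + b)
    col u with u ∈? A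
    ... | yes _ = colA u ↑ˡ b
    ... | no _  = a ↑ʳ colB u

    proper : ∀ {u w} → u ∈ X → w ∈ X → u ~ w → col u ≢ col w
    proper {u} {w} u∈X w∈X u~w with u ∈? A | w ∈? A
    ... | yes u∈A | yes w∈A = properA (x∈p∩q⁺ (u∈X , u∈A)) (x∈p∩q⁺ (w∈X , w∈A)) u~w ∘ ↑ˡ-injective b _ _
    ... | yes _   | no _    = ↑ˡ≢↑ʳ _ _
    ... | no _    | yes _   = ↑ˡ≢↑ʳ _ _ ∘ sym
    ... | no u∉A  | no w∉A  with outside-A-in-B u∈X w∈X u∉A w∉A u~w
    ...   | u∈B , w∈B = properB u∈B w∈B u~w ∘ ↑ʳ-injective a _ _

  record MaximalIndependentIn (X I : VertexSet) : Set where
    field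
      I⊆X         : I ⊆ X
      independent : ∀ {u w} → u ∈ I → w ∈ I → ¬ u ~ w
      maximal     : ∀ {u} → u ∈ X → u ∉ I → ¬ (∀ s → s ∈ I → ¬ u ~ s)

  maximalIndependentIn : ∀ X → ∃ (MaximalIndependentIn X)
  maximalIndependentIn X = extend ∅ (⊃-wellFounded ∅) ⊥⊆ (⊥-elim ∘ ∉⊥)
    where
    extend : ∀ I → Acc _⊃_ I → I ⊆ X → (∀ {u w} → u ∈ I → w ∈ I → ¬ u ~ w) → ∃ (MaximalIndependentIn X)
    extend I (acc larger) I⊆X independent
      with any? (λ u → u ∈? X ×-dec ¬? (u ∈? I) ×-dec all? λ s → s ∈? I →-dec ¬? (Bool.T? (adj G u s)))
    ... | no none = I , record
      { I⊆X = I⊆X ; independent = independent ; maximal = λ u∈X u∉I apart → none (_ , u∈X , u∉I , apart) }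
    ... | yes (u , u∈X , u∉I , apart) = extend (I ∪ ⁅ u ⁆) (larger I⊂I+u) I+u⊆X independent′
      where
      I⊂I+u : (I ∪ ⁅ u ⁆) ⊃ I
      I⊂I+u = p⊆p∪q ⁅ u ⁆ , u , x∈p∪q⁺ (inj₂ (x∈⁅x⁆ u)) , u∉I
      I+u⊆X : I ∪ ⁅ u ⁆ ⊆ X
      I+u⊆X x∈ = [ I⊆X , (λ { refl → u∈X }) ]′ (∈-∪⁅⁆⁻ x∈)
      independent′ : ∀ {x y} → x ∈ I ∪ ⁅ u ⁆ → y ∈ I ∪ ⁅ u ⁆ → ¬ x ~ y
      independent′ x∈ y∈ with ∈-∪⁅⁆⁻ x∈ | ∈-∪⁅⁆⁻ y∈
      ... | inj₁ x∈I | inj₁ y∈I = independent x∈I y∈I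
      ... | inj₁ x∈I | inj₂ refl = apart _ x∈I ∘ ~-sym
      ... | inj₂ refl | inj₁ y∈I = apart _ y∈I
      ... | inj₂ refl | inj₂ refl = ~-irrefl

  module _ {X I : VertexSet} (P₄-free : FreeIn 4 P₄ X) (mis : MaximalIndependentIn X I) where
    open MaximalIndependentIn mis

    maximalClique-meets : ∀ {k} (q : Fin (suc k) → Vertex) → IsCliqueIn q X →
      (∀ {w} → w ∈ X → ¬ (∀ i → w ~ q i)) → ¬ (∀ i → q i ∉ I)
    maximalClique-meets {k} q clique maximalClique q∉I =
      maximal (∈X 0F) (q∉I 0F) λ s s∈I _ → I-empty s (wellFounded traces ⊃-wellFounded s) s∈I
      where
      open IsCliqueIn clique
      traces : Vertex → Subset (suc k)
      traces s = tabulate λ i → adj G s (q i)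

      ∈-traces⁺ : ∀ {s i} → s ~ q i → i ∈ traces s
      ∈-traces⁺ {s} = ∈-tabulate⁺ (λ i → adj G s (q i))

      ∈-traces⁻ : ∀ {s i} → i ∈ traces s → s ~ q i
      ∈-traces⁻ {s} = ∈-tabulate⁻ (λ i → adj G s (q i))

      -- If s ∈ I misses q i′, the I-neighbour s′ of q i′ sees strictly more of q than s does,
      -- since a q i seen by s but not by s′ would give the induced path s - q i - q i′ - s′.
      I-empty : ∀ s → Acc (_⊃_ on traces) s → s ∉ I
      I-empty s (acc more) s∈I =
        maximalClique (I⊆X s∈I) λ i → decidable-stable (Bool.T? _) (escape i)
        where
        escape : ∀ i′ → ¬ ¬ s ~ q i′
        escape i′ s≁qi′ = maximal (∈X i′) (q∉I i′) λ s′ s′∈I qi′~s′ → I-empty s′ (more (grows s′ s′∈I qi′~s′)) s′∈I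
          where
          grows : ∀ s′ → s′ ∈ I → q i′ ~ s′ → traces s′ ⊃ traces s
          grows s′ s′∈I qi′~s′ = sees , i′ , ∈-traces⁺ (~-sym qi′~s′) , s≁qi′ ∘ ∈-traces⁻
            where
            sees : ∀ {i} → i ∈ traces s → i ∈ traces s′
            sees {i} i∈ = ∈-traces⁺ (decidable-stable (Bool.T? _) λ s′≁qi → P₄-free
              (path-copy (I⊆X s∈I) (∈X i) (∈X i′) (I⊆X s′∈I)
                s~qi (adjacent i≢i′) qi′~s′ s≁qi′ (independent s∈I s′∈I) (s′≁qi ∘ ~-sym)))
              where
              s~qi : s ~ q i
              s~qi = ∈-traces⁻ i∈
              i≢i′ : i ≢ i′
              i≢i′ refl = s≁qi′ s~qi

  cograph-colouring : ∀ c {X} → FreeIn 4 P₄ X → CliqueFree (2 + c) X → ColouringOf X (suc c)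
  cograph-colouring zero    _ K₂-free = independent-colouring (cliqueFree₂⇒independent K₂-free)
  cograph-colouring (suc c) {X} P₄-free K-free =
    colouring-join (independent-colouring λ u∈ w∈ → independent (I∩ u∈) (I∩ w∈)) rest-colouring
      λ u∈X w∈X u∉I w∉I _ → rest⁺ u∈X u∉I , rest⁺ w∈X w∉I
    where
    I : VertexSet
    I = proj₁ (maximalIndependentIn X)
    mis : MaximalIndependentIn X I
    mis = proj₂ (maximalIndependentIn X)
    open MaximalIndependentIn mis
    I∩ : ∀ {u} → u ∈ X ∩ I → u ∈ I
    I∩ = proj₂ ∘ x∈p∩q⁻ X I
    rest⁺ : ∀ {u} → u ∈ X → u ∉ I → u ∈ X ∩ ∁ I
    rest⁺ u∈X u∉I = x∈p∩q⁺ (u∈X , x∉p⇒x∈∁p u∉I)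
    rest-cliqueFree : CliqueFree (2 + c) (X ∩ ∁ I)
    rest-cliqueFree q clique = maximalClique-meets P₄-free mis q clique-in-X
      (λ w∈X w~q → K-free _ (clique-cons clique-in-X w∈X w~q))
      (x∈∁p⇒x∉p ∘ proj₂ ∘ x∈p∩q⁻ X _ ∘ IsCliqueIn.∈X clique)
      where
      clique-in-X : IsCliqueIn q X
      clique-in-X = IsCliqueIn-⊆ (p∩q⊆p X _) clique
    rest-colouring : ColouringOf (X ∩ ∁ I) (suc c)
    rest-colouring = cograph-colouring c (FreeIn-antitone (p∩q⊆p X _) P₄-free) rest-cliqueFree

  -- v lies outside X ∩ nonNbhd v, yet colour-joining gives it the (junk) colour that the
  -- colouring of that set assigns to it; harmless, since v has no neighbour there.
  colouring-step : ∀ ℓ {c F X} → (∀ {Z} → Z ⊆ X → CliqueFree (suc c) Z → ColouringOf Z F) →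
    FreeIn (4 + ℓ) (P4+P1s-adj ℓ) X → CliqueFree (2 + c) X → ColouringOf X (ℓ * F + suc c)
  colouring-step zero {c} _ P₄-free K-free = cograph-colouring c P₄-free K-free
  colouring-step (suc ℓ) {c} {F} {X} colour-smaller P-free K-free =
    subst (ColouringOf X) (sym (+-assoc F (ℓ * F) (suc c))) peel
    where
    peel : ColouringOf X (F + (ℓ * F + suc c))
    peel with nonempty? X
    ... | no X-empty = ColouringOf-weaken (m≤n+m _ F)
      (colouring-step ℓ colour-smaller (λ copy → X-empty (_ , CopyIn.vertex∈X copy 0F)) K-free)
    ... | yes (v , v∈X) = colouring-join nbhd-colouring rest-colouring non-neighbours-of-v
      where
      nbhd-colouring : ColouringOf (X ∩ nbhd v) F
      nbhd-colouring = colour-smaller (p∩q⊆p X _) (CliqueFree-nbhd K-free v∈X)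

      rest-colouring : ColouringOf (X ∩ nonNbhd v) (ℓ * F + suc c)
      rest-colouring = colouring-step ℓ (λ Z⊆ → colour-smaller (⊆-trans Z⊆ (p∩q⊆p X _)))
        (FreeIn-nonNbhd P-free v∈X) (CliqueFree-antitone (p∩q⊆p X _) K-free)

      non-neighbours-of-v : ∀ {u w} → u ∈ X → w ∈ X → u ∉ nbhd v → w ∉ nbhd v → u ~ w →
        u ∈ X ∩ nonNbhd v × w ∈ X ∩ nonNbhd v
      non-neighbours-of-v u∈X w∈X u∉N w∉N u~w =
        x∈p∩q⁺ (u∈X , ∈-nonNbhd⁺ (u∉N ∘ ∈-nbhd⁺) λ { refl → w∉N (∈-nbhd⁺ u~w) }) ,
        x∈p∩q⁺ (w∈X , ∈-nonNbhd⁺ (w∉N ∘ ∈-nbhd⁺) λ { refl → u∉N (∈-nbhd⁺ (~-sym u~w)) })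

  colouring-bound : ∀ ℓ c {X} → FreeIn (4 + ℓ) (P4+P1s-adj ℓ) X → CliqueFree (2 + c) X →
    ColouringOf X (bound ℓ (2 + c))
  colouring-bound ℓ zero    _ K₂-free = independent-colouring (cliqueFree₂⇒independent K₂-free)
  colouring-bound ℓ (suc c) P-free K-free = subst (ColouringOf _) (sym (bound-suc ℓ c))
    (colouring-step ℓ (λ Z⊆X → colouring-bound ℓ c (FreeIn-antitone Z⊆X P-free)) P-free K-free)

K-adj-refl : ∀ {k} (i : Fin k) → K-adj k i i ≡ false
K-adj-refl i = cong not (Equivalence.to Bool.T-≡ (≡⇒≡ᵇ (toℕ i) (toℕ i) refl))

K-adj-≢ : ∀ {k} {i j : Fin k} → i ≢ j → K-adj k i j ≡ true
K-adj-≢ {i = i} {j} i≢j = cong not (dec-false (Bool.T? _) (i≢j ∘ toℕ-injective ∘ ≡ᵇ⇒≡ (toℕ i) (toℕ j)))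

Free⇒FreeIn : ∀ {G m F} → Free m F G → FreeIn G m F ⊤
Free⇒FreeIn free c = free (vertex , injective , induced)
  where open CopyIn c

Free-K⇒CliqueFree : ∀ {G k} → Free k (K-adj k) G → CliqueFree G k ⊤
Free-K⇒CliqueFree {G} {k} free q clique = free (q , clique-injective G clique , induced)
  where
  induced : ∀ i j → K-adj k i j ≡ adj G (q i) (q j)
  induced i j with i ≟ j
  ... | yes refl = trans (K-adj-refl i) (sym (irr G (q i)))
  ... | no i≢j   = trans (K-adj-≢ i≢j) (sym (edge G (IsCliqueIn.adjacent clique i≢j)))

ColouringOf-⊤⇒χ≤ : ∀ {G c} → ColouringOf G ⊤ c → χ≤ G c
ColouringOf-⊤⇒χ≤ (col , proper) = col , λ u w → proper (∈⊤ {x = u}) (∈⊤ {x = w})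

theorem5 : (ℓ k : ℕ) → 3 ≤ k → (G : Graph) →
    Free (4 + ℓ) (P4+P1s-adj ℓ) G → Free k (K-adj k) G → χ≤ G (bound ℓ k)
theorem5 ℓ (suc zero) (s≤s ()) G
theorem5 ℓ (suc (suc c)) _ G P-free K-free =
  ColouringOf-⊤⇒χ≤ {G} (colouring-bound G ℓ c (Free⇒FreeIn P-free) (Free-K⇒CliqueFree K-free))
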